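{- Let $S$ be a set of patterns none of which begins with $1$ (i.e. $\pi(1)\neq 1$ for all $\pi\in S$). For $k\ge 0$ let $t_k$ and $f_k$ be the numbers of rooted labeled trees and forests on $[k]$ avoiding $S$ (with $t_0=0$, $f_0=1$). Then $t_{k+1}\ge f_k$ for all $k\ge 0$. Consequently all coefficients of the power series $A(x)=\sum_{k\ge0}\frac{(t_{k+1}-f_k)x^k}{k!}$ are nonnegative.
   Context: A pattern is a permutation $\pi=\pi(1)\cdots\pi(k)$ of $[k]$. A rooted labeled forest on $[n]$ is an unordered forest on $n$ vertices with distinct labels from $[n]$ and a distinguished root in each component; a tree is a forest with one component. A forest avoids $S$ if there is no sequence of vertices $v_1,\dots,v_k$, with $v_i$ an ancestor of $v_{i+1}$, whose labels are in the same relative order as some $\pi\in S$ of length $k$. -}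

module Defs where

open import Data.Nat using (ℕ; suc)
open import Data.Fin using (Fin; toℕ) renaming (_<_ to _<ᶠ_)
open import Data.Maybe using (Maybe; just; nothing)
open import Data.Vec using (Vec; lookup)
open import Data.List using (List; length)
open import Data.List.Membership.Propositional using (_∈_)
open import Data.List.Relation.Unary.Unique.Propositional using (Unique)
open import Data.Product using (Σ; _×_; ∃)
open import Relation.Binary.PropositionalEquality using (_≡_; _≢_)
open import Relation.Nullary using (¬_)
open import Function.Bundles using (_⇔_)

-- A rooted labeled forest on [n] (vertices = labels = Fin n) is encoded by
-- its parent map: entry v is  just u  if u is the parent of v, and
-- nothing  if v is a root.
ParentMap : ℕ → Set
ParentMap n = Vec (Maybe (Fin n)) n

parent : ∀ {n} → ParentMap n → Fin n → Maybe (Fin n)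
parent p v = lookup p v

data Anc {n : ℕ} (p : ParentMap n) (u : Fin n) : Fin n → Set where
  here  : ∀ {v} → parent p v ≡ just u → Anc p u v
  there : ∀ {v w} → parent p v ≡ just w → Anc p u w → Anc p u v

IsForest : ∀ {n} → ParentMap n → Set
IsForest {n} p = (v : Fin n) → ¬ Anc p v v

IsRoot : ∀ {n} → ParentMap n → Fin n → Set
IsRoot p v = parent p v ≡ nothing

IsTree : ∀ {n} → ParentMap n → Set
IsTree {n} p = IsForest p × (Σ (Fin n) λ r → IsRoot p r × ((v : Fin n) → IsRoot p v → v ≡ r))

-- A pattern of length k is a permutation of [k], given as a function
-- Fin k → Fin k (π i = value at position i, 0-based).
IsPermutation : ∀ {k} → (Fin k → Fin k) → Set
IsPermutation {k} π = (i j : Fin k) → π i ≡ π j → i ≡ j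

PatternSet : Set₁
PatternSet = (k : ℕ) → (Fin k → Fin k) → Set

Chain : ∀ {n k} → ParentMap n → (Fin k → Fin n) → Set
Chain {n} {k} p v = (i j : Fin k) → suc (toℕ i) ≡ toℕ j → Anc p (v i) (v j)

SameOrder : ∀ {n k} → (Fin k → Fin n) → (Fin k → Fin k) → Set
SameOrder {n} {k} v π = (i j : Fin k) → (v i <ᶠ v j) ⇔ (π i <ᶠ π j)

Contains : ∀ {n k} → ParentMap n → (Fin k → Fin k) → Set
Contains {n} {k} p π = Σ (Fin k → Fin n) λ v → Chain p v × SameOrder v π

Avoids : ∀ {n} → ParentMap n → PatternSet → Set
Avoids p S = (k : ℕ) (π : Fin _ → Fin _) → S k π → ¬ Contains p π

NumberOf : {A : Set} → (A → Set) → ℕ → Set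
NumberOf {A} P m = Σ (List A) λ xs → Unique xs × ((x : A) → (x ∈ xs) ⇔ P x) × length xs ≡ m

TreeCount : PatternSet → ℕ → ℕ → Set
TreeCount S k m = NumberOf {ParentMap k} (λ p → IsTree p × Avoids p S) m

ForestCount : PatternSet → ℕ → ℕ → Set
ForestCount S k m = NumberOf {ParentMap k} (λ p → IsForest p × Avoids p S) m

{-# OPTIONS --safe #-}
-- Hang a forest on [k] below a new root carrying the smallest label, shifting
-- all other labels up by one.  This is an injection from forests on [k] into
-- trees on [k+1].  An occurrence of a pattern in the new tree either avoids the
-- root, and is then an occurrence in the forest, or starts at the root (the
-- root is an ancestor of every vertex and has none itself); in the latter case
-- the pattern starts with its minimum, i.e. with 1, which S forbids.
module Submission where

open import Defs
open import Data.Nat using (ℕ; suc; _≤_; z≤n; s≤s)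
open import Data.Nat.Properties using (≤-pred; n≮0; n<1+n; <⇒≱)
open import Data.Fin using (Fin; zero; suc; toℕ; inject₁; punchOut; _≟_) renaming (_<_ to _<ᶠ_)
open import Data.Fin.Properties
  using (toℕ-inject₁; punchOut-injective; punchIn-punchOut; injective⇒≤; ≤∧≢⇒<)
open import Data.Maybe using (Maybe; just; nothing)
open import Data.Vec using ([]; _∷_; map; head; tail)
open import Data.Vec.Properties using (lookup-map)
open import Data.List using (List; length; lookup)
open import Data.List.Membership.Propositional.Properties using (∈-lookup)
open import Data.List.Relation.Unary.Any using (index)
open import Data.List.Relation.Unary.Any.Properties using (lookup-index)
import Data.List.Relation.Unary.All as All
open import Data.List.Relation.Unary.AllPairs using (_∷_)
open import Data.List.Relation.Unary.Unique.Propositional using (Unique)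
open import Data.Product using (_,_)
open import Data.Sum using (_⊎_; inj₁; inj₂)
open import Function using (_∘_)
open import Function.Bundles using (mk⇔; Equivalence)
open import Function.Definitions using (Injective)
open import Relation.Binary.PropositionalEquality
open import Relation.Nullary using (¬_; yes; no; contradiction)

unique⇒lookup-injective : ∀ {A : Set} {xs : List A} → Unique xs → Injective _≡_ _≡_ (lookup xs)
unique⇒lookup-injective (x∉ ∷ u) {zero}  {zero}  _  = refl
unique⇒lookup-injective (x∉ ∷ u) {zero}  {suc j} eq = contradiction eq (All.lookup x∉ (∈-lookup j))
unique⇒lookup-injective (x∉ ∷ u) {suc i} {zero}  eq = contradiction (sym eq) (All.lookup x∉ (∈-lookup i))
unique⇒lookup-injective (x∉ ∷ u) {suc i} {suc j} eq = cong suc (unique⇒lookup-injective u eq)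

NumberOf-mono : ∀ {A B : Set} {P : A → Set} {Q : B → Set} {m n : ℕ} (g : A → B)
  → Injective _≡_ _≡_ g → (∀ {x} → P x → Q (g x))
  → NumberOf P m → NumberOf Q n → m ≤ n
NumberOf-mono g g-inj P⇒Q (xs , xs-unique , xs-enum , refl) (ys , _ , ys-enum , refl) =
  injective⇒≤ position-injective
  where
  position : Fin (length xs) → Fin (length ys)
  position i = index (Equivalence.from (ys-enum _) (P⇒Q (Equivalence.to (xs-enum _) (∈-lookup i))))

  lookup-position : ∀ i → g (lookup xs i) ≡ lookup ys (position i)
  lookup-position i = lookup-index (Equivalence.from (ys-enum _) _)

  position-injective : Injective _≡_ _≡_ position
  position-injective {i} {j} eq = unique⇒lookup-injective xs-unique (g-inj (begin
    g (lookup xs i)        ≡⟨ lookup-position i ⟩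
    lookup ys (position i) ≡⟨ cong (lookup ys) eq ⟩
    lookup ys (position j) ≡⟨ lookup-position j ⟨
    g (lookup xs j)        ∎))
    where open ≡-Reasoning

injective-minimum≡zero : ∀ {k} {π : Fin (suc k) → Fin (suc k)} {i} → Injective _≡_ _≡_ π
  → (∀ j → ¬ π j <ᶠ π i) → π i ≡ zero
injective-minimum≡zero {k} {π} {i} π-inj π-min with π i ≟ zero
... | yes πi≡0 = πi≡0
... | no  πi≢0 = contradiction (injective⇒≤ shrink-injective) (<⇒≱ (n<1+n k))
  where
  zero∉image : ∀ j → zero ≢ π j
  zero∉image j 0≡πj = π-min j (subst (_<ᶠ π i) 0≡πj (≤∧≢⇒< z≤n (πi≢0 ∘ sym)))

  shrink : Fin (suc k) → Fin k
  shrink j = punchOut (zero∉image j)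

  shrink-injective : Injective _≡_ _≡_ shrink
  shrink-injective eq = π-inj (punchOut-injective (zero∉image _) (zero∉image _) eq)

shiftParent : ∀ {k} → Maybe (Fin k) → Maybe (Fin (suc k))
shiftParent (just u) = just (suc u)
shiftParent nothing  = just zero

addRoot : ∀ {k} → ParentMap k → ParentMap (suc k)
addRoot p = nothing ∷ map shiftParent p

shiftParent-injective : ∀ {k} → Injective _≡_ _≡_ (shiftParent {k})
shiftParent-injective {x = just _}  {just _}  refl = refl
shiftParent-injective {x = nothing} {nothing} refl = refl
shiftParent-injective {x = just _}  {nothing} ()
shiftParent-injective {x = nothing} {just _}  ()

shiftParent≢nothing : ∀ {k} {x : Maybe (Fin k)} → shiftParent x ≢ nothing
shiftParent≢nothing {x = just _}  ()
shiftParent≢nothing {x = nothing} ()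

map-shiftParent-injective : ∀ {k n} → Injective _≡_ _≡_ (map {n = n} (shiftParent {k}))
map-shiftParent-injective {x = []}    {[]}    _  = refl
map-shiftParent-injective {x = _ ∷ _} {_ ∷ _} eq =
  cong₂ _∷_ (shiftParent-injective (cong head eq)) (map-shiftParent-injective (cong tail eq))

addRoot-injective : ∀ {k} → Injective _≡_ _≡_ (addRoot {k})
addRoot-injective eq = map-shiftParent-injective (cong tail eq)

parent-addRoot-suc : ∀ {k} (p : ParentMap k) v → parent (addRoot p) (suc v) ≡ shiftParent (parent p v)
parent-addRoot-suc p v = lookup-map v shiftParent p

parent-addRoot-suc-just : ∀ {k} (p : ParentMap k) {u v}
  → parent (addRoot p) (suc v) ≡ just (suc u) → parent p v ≡ just u
parent-addRoot-suc-just p {v = v} eq = shiftParent-injective (trans (sym (parent-addRoot-suc p v)) eq)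

¬Anc-addRoot-zero : ∀ {k} {p : ParentMap k} {u} → ¬ Anc (addRoot p) u zero
¬Anc-addRoot-zero (here ())
¬Anc-addRoot-zero (there () _)

Anc-addRoot-suc⁻ : ∀ {k} {p : ParentMap k} {u v} → Anc (addRoot p) (suc u) (suc v) → Anc p u v
Anc-addRoot-suc⁻ {p = p} (here e) = here (parent-addRoot-suc-just p e)
Anc-addRoot-suc⁻ (there {w = zero} _ a) = contradiction a ¬Anc-addRoot-zero
Anc-addRoot-suc⁻ {p = p} (there {w = suc _} e a) = there (parent-addRoot-suc-just p e) (Anc-addRoot-suc⁻ a)

addRoot-isForest : ∀ {k} {p : ParentMap k} → IsForest p → IsForest (addRoot p)
addRoot-isForest p-forest zero    = ¬Anc-addRoot-zero
addRoot-isForest p-forest (suc v) = p-forest v ∘ Anc-addRoot-suc⁻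

addRoot-isTree : ∀ {k} {p : ParentMap k} → IsForest p → IsTree (addRoot p)
addRoot-isTree {p = p} p-forest = addRoot-isForest p-forest , zero , refl , onlyRoot
  where
  onlyRoot : ∀ v → IsRoot (addRoot p) v → v ≡ zero
  onlyRoot zero    _ = refl
  onlyRoot (suc v) r = contradiction (trans (sym (parent-addRoot-suc p v)) r) shiftParent≢nothing

Contains-addRoot⁻ : ∀ {k n} {p : ParentMap n} {π : Fin (suc k) → Fin (suc k)}
  → Injective _≡_ _≡_ π → Contains (addRoot p) π → π zero ≡ zero ⊎ Contains p π
Contains-addRoot⁻ {k} {n} {p} {π} π-inj (w , chain , order) with w zero ≟ zero
... | yes w0≡0 = inj₁ (injective-minimum≡zero π-inj below-w0-impossible)
  where
  below-w0-impossible : ∀ j → ¬ π j <ᶠ π zero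
  below-w0-impossible j πj<π0 =
    n≮0 (subst (w j <ᶠ_) w0≡0 (Equivalence.from (order j zero) πj<π0))
... | no  w0≢0 = inj₂ (w′ , chain′ , order′)
  where
  w≢0 : ∀ j → zero ≢ w j
  w≢0 zero    = w0≢0 ∘ sym
  w≢0 (suc j) 0≡wj = ¬Anc-addRoot-zero
    (subst (Anc (addRoot p) (w (inject₁ j))) (sym 0≡wj) (chain (inject₁ j) (suc j) (cong suc (toℕ-inject₁ j))))

  w′ : Fin (suc k) → Fin n
  w′ j = punchOut (w≢0 j)

  suc-w′ : ∀ j → suc (w′ j) ≡ w j
  suc-w′ j = punchIn-punchOut (w≢0 j)

  chain′ : Chain p w′
  chain′ i j i→j = Anc-addRoot-suc⁻ (subst₂ (Anc (addRoot p)) (sym (suc-w′ i)) (sym (suc-w′ j)) (chain i j i→j))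

  order′ : SameOrder w′ π
  order′ i j = mk⇔
    (λ lt → Equivalence.to (order i j) (subst₂ _<ᶠ_ (suc-w′ i) (suc-w′ j) (s≤s lt)))
    (λ lt → ≤-pred (subst₂ _<ᶠ_ (sym (suc-w′ i)) (sym (suc-w′ j)) (Equivalence.from (order i j) lt)))

addRoot-avoids : ∀ (S : PatternSet)
  → (∀ k (π : Fin k → Fin k) → S k π → IsPermutation π)
  → (∀ k (π : Fin (suc k) → Fin (suc k)) → S (suc k) π → π zero ≢ zero)
  → ∀ {n} {p : ParentMap n} → Avoids p S → Avoids (addRoot p) S
addRoot-avoids S perm no1 p-avoids 0 π Sπ _ = p-avoids 0 π Sπ ((λ ()) , (λ ()) , (λ ()))
addRoot-avoids S perm no1 p-avoids (suc k) π Sπ occ with Contains-addRoot⁻ (perm _ π Sπ _ _) occ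
... | inj₁ π0≡0 = no1 k π Sπ π0≡0
... | inj₂ occ′ = p-avoids (suc k) π Sπ occ′

proposition3p2 : (S : PatternSet)
    → (∀ k (π : Fin k → Fin k) → S k π → IsPermutation π)
    → (∀ k (π : Fin (suc k) → Fin (suc k)) → S (suc k) π → π zero ≢ zero)
    → (k t f : ℕ) → TreeCount S (suc k) t → ForestCount S k f → f ≤ t
proposition3p2 S perm no1 k t f trees forests =
  NumberOf-mono addRoot addRoot-injective
    (λ (p-forest , p-avoids) → addRoot-isTree p-forest , addRoot-avoids S perm no1 p-avoids)
    forests trees
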